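{- Let $G \in \mathcal{C}$, let $S$ be a minimal separator of $G$, let $D$ be a full component of $S$, and let $Z \subseteq D$ be an inclusion-wise minimal set such that $G[Z]$ is connected and $S \subseteq N(Z)$. Then for every $z \in Z$ there exists $f(z) \in S$ such that $z$ is the unique neighbor of $f(z)$ in $Z$.
   Context: A hole is an induced cycle of length at least $4$. An extended $C_5$ is a six-vertex graph obtained from a five-vertex hole by adding a vertex adjacent to exactly one vertex or exactly two consecutive vertices of the hole. $\mathcal{C}$ is the class of graphs with no hole of length at least $6$ and no extended $C_5$ as an induced subgraph. $N(X)$ is the open neighborhood of $X$. A set $S$ is a minimal separator if $G-S$ has at least two connected components $D$ with $N(D)=S$; these are the full components of $S$. -}

module Defs where

open import Data.Nat using (ℕ; zero; suc; _≤_)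
open import Data.Fin using (Fin; toℕ)
open import Data.Fin.Subset using (Subset; _∈_; _∉_; _⊆_)
open import Data.Bool using (Bool; T)
open import Data.Product using (Σ; ∃; _×_; _,_)
open import Data.Sum using (_⊎_)
open import Relation.Binary.PropositionalEquality using (_≡_; _≢_)
open import Relation.Nullary using (¬_)
open import Function.Bundles using (_⇔_)
open import Function.Definitions using (Injective)

record Graph (n : ℕ) : Set where
  field
    adj   : Fin n → Fin n → Bool
    sym   : ∀ u v → adj u v ≡ adj v u
    irrefl : ∀ u → adj u u ≡ Data.Bool.false

open Graph public

Adj : ∀ {n} → Graph n → Fin n → Fin n → Set
Adj G u v = T (adj G u v)

Consec : (k : ℕ) → Fin k → Fin k → Set
Consec k i j =
  (toℕ j ≡ suc (toℕ i)) ⊎ (toℕ i ≡ suc (toℕ j)) ⊎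
  ((toℕ i ≡ 0 × suc (toℕ j) ≡ k) ⊎ (toℕ j ≡ 0 × suc (toℕ i) ≡ k))

IsInducedCycle : ∀ {n} → Graph n → (k : ℕ) → (Fin k → Fin n) → Set
IsInducedCycle G k c =
  Injective _≡_ _≡_ c × (∀ i j → Adj G (c i) (c j) ⇔ Consec k i j)

IsHole : ∀ {n} → Graph n → (k : ℕ) → (Fin k → Fin n) → Set
IsHole G k c = (4 ≤ k) × IsInducedCycle G k c

HasExtendedC5 : ∀ {n} → Graph n → Set
HasExtendedC5 {n} G =
  Σ (Fin 5 → Fin n) λ c → Σ (Fin n) λ v →
    IsHole G 5 c × (∀ i → v ≢ c i) ×
    ( (Σ (Fin 5) λ i → ∀ j → Adj G v (c j) ⇔ (j ≡ i))
    ⊎ (Σ (Fin 5) λ i → Σ (Fin 5) λ i' → Consec 5 i i' ×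
         (∀ j → Adj G v (c j) ⇔ (j ≡ i ⊎ j ≡ i'))))

InClassC : ∀ {n} → Graph n → Set
InClassC G =
  (∀ k (c : Fin k → Fin _) → 6 ≤ k → ¬ IsHole G k c) × ¬ HasExtendedC5 G

-- walks inside a vertex set X
data PathIn {n} (G : Graph n) (X : Subset n) : Fin n → Fin n → Set where
  here : ∀ {u} → u ∈ X → PathIn G X u u
  step : ∀ {u w v} → u ∈ X → Adj G u w → PathIn G X w v → PathIn G X u v

-- G[X] is connected (the empty set counts as connected)
Connected : ∀ {n} → Graph n → Subset n → Set
Connected G X = ∀ u v → u ∈ X → v ∈ X → PathIn G X u v

InN : ∀ {n} → Graph n → Subset n → Fin n → Set
InN G X v = v ∉ X × (Σ _ λ x → x ∈ X × Adj G v x)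

IsComponent : ∀ {n} → Graph n → Subset n → Subset n → Set
IsComponent G S D =
  (Σ _ λ d → d ∈ D) × (∀ v → v ∈ D → v ∉ S) × Connected G D ×
  (∀ u v → u ∈ D → Adj G u v → v ∉ S → v ∈ D)

IsFullComponent : ∀ {n} → Graph n → Subset n → Subset n → Set
IsFullComponent G S D = IsComponent G S D × (∀ v → InN G D v ⇔ v ∈ S)

-- S is a minimal separator: G - S has at least two full components
IsMinimalSeparator : ∀ {n} → Graph n → Subset n → Set
IsMinimalSeparator G S =
  Σ _ λ D₁ → Σ _ λ D₂ → D₁ ≢ D₂ × IsFullComponent G S D₁ × IsFullComponent G S D₂

Dominating : ∀ {n} → Graph n → Subset n → Subset n → Set
Dominating G S Z = Connected G Z × (∀ s → s ∈ S → InN G Z s)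

module Submission where

-- Suppose every S-neighbour of z has a second neighbour in Z, and let D' be a second full
-- component of S.  Let x₁ be a neighbour of z in Z and R the set of vertices reachable from x₁
-- in Z ∖ {z}.  By minimality Z ∖ {z} does not dominate S, so R ≠ Z ∖ {z}; hence Z₁ = {z} ∪ R and
-- Z₂ = Z ∖ R are connected proper subsets of Z, and again by minimality some t₂ ∈ S has no
-- neighbour in Z₁ and some t₁ ∈ S none in Z₂.  An induced path from t₁ through Z to t₂ starts
-- in R and can only leave R through z, so it has at least three interior vertices.  Closing it
-- up through D', or through the edge t₁t₂, gives a hole of length at least 6, or a 5-hole with a
-- neighbour of t₁ in D' attached as an extended C₅.  Decidability of reachability is only
-- available under double negation, which suffices since the argument derives ⊥.

open import Data.Bool using (T; false)
import Data.Bool.Properties as Bool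
open import Data.Empty using (⊥; ⊥-elim)
open import Data.Fin using (Fin; toℕ; zero; suc)
open import Data.Fin.Properties using (_≟_; any?; all?)
open import Data.Fin.Subset using (Subset; _∈_; _∉_; _⊆_) renaming (⊥ to ∅)
open import Data.Fin.Subset.Properties using (⊆-antisym; _∈?_; ∉⊥)
open import Data.List using (List; []; _∷_; _++_; [_]; length; lookup)
open import Data.List.Membership.Propositional.Properties using (∈-lookup)
open import Data.List.Properties using (length-++)
open import Data.List.Relation.Unary.All as All using (All; []; _∷_)
open import Data.List.Relation.Unary.All.Properties using (¬Any⇒All¬; ++⁺; ++⁻ˡ; ++⁻ʳ; ++⁻)
open import Data.List.Relation.Unary.Any as Any using (Any; here; there)
open import Data.Nat using (zero; suc; _≤_; s≤s; z≤n)
open import Data.Nat.Properties using (suc-injective; ≤-trans; m≤n+m)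
open import Data.Product using (Σ; _×_; _,_; proj₁; proj₂)
open import Data.Sum using (_⊎_; inj₁; inj₂; [_,_]′)
open import Data.Unit using (⊤; tt)
import Data.Vec as Vec
open import Data.Vec.Properties using (lookup∘tabulate; []=⇒lookup; lookup⇒[]=; ≡-dec)
open import Function.Base using (_∘_)
open import Function.Bundles using (_⇔_; mk⇔; Equivalence)
open import Relation.Binary.PropositionalEquality using (_≡_; _≢_; refl; sym; trans; cong; subst)
open import Relation.Nullary using (¬_; Dec; yes; no)
open import Relation.Nullary.Decidable
  using (T?; does; dec-true; decidable-stable; ¬¬-excluded-middle; _⊎-dec_; _×-dec_; _→-dec_; ¬?)
open import Relation.Unary using (Decidable)

open import Defs hiding (sym)

module Walks {n} (G : Graph n) where

  infix 4 _~_ _~?_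

  _~_ : Fin n → Fin n → Set
  _~_ = Adj G

  _~?_ : ∀ u v → Dec (u ~ v)
  u ~? v = T? (adj G u v)

  ~-sym : ∀ {u v} → u ~ v → v ~ u
  ~-sym {u} {v} = subst T (Graph.sym G u v)

  ~-irrefl : ∀ {u} → ¬ u ~ u
  ~-irrefl {u} u~u with adj G u u | Graph.irrefl G u
  ... | false | _ = u~u

  path-start : ∀ {X u v} → PathIn G X u v → u ∈ X
  path-start (here u∈X) = u∈X
  path-start (step u∈X _ _) = u∈X

  path-end : ∀ {X u v} → PathIn G X u v → v ∈ X
  path-end (here v∈X) = v∈X
  path-end (step _ _ p) = path-end p

  path-snoc : ∀ {X u v w} → PathIn G X u v → v ~ w → w ∈ X → PathIn G X u w
  path-snoc (here u∈X) v~w w∈X = step u∈X v~w (here w∈X)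
  path-snoc (step u∈X u~x p) v~w w∈X = step u∈X u~x (path-snoc p v~w w∈X)

  path-reverse : ∀ {X u v} → PathIn G X u v → PathIn G X v u
  path-reverse (here u∈X) = here u∈X
  path-reverse (step u∈X u~w p) = path-snoc (path-reverse p) (~-sym u~w) u∈X

  path-++ : ∀ {X u v w} → PathIn G X u v → PathIn G X v w → PathIn G X u w
  path-++ (here _) q = q
  path-++ (step u∈X u~x p) q = step u∈X u~x (path-++ p q)

  connected-from : ∀ {X r} → (∀ u → u ∈ X → PathIn G X r u) → Connected G X
  connected-from path u v u∈X v∈X = path-++ (path-reverse (path u u∈X)) (path v v∈X)

  last-step : ∀ {X u z} → PathIn G X u z → u ≢ z → Σ (Fin n) λ v → v ∈ X × v ≢ z × v ~ z
  last-step (here _) u≢z = ⊥-elim (u≢z refl)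
  last-step {z = z} (step {w = w} u∈X u~w p) u≢z with w ≟ z
  ... | yes refl = _ , u∈X , u≢z , u~w
  ... | no w≢z = last-step p w≢z

module InducedPaths {n} (G : Graph n) where

  open Walks G

  Apart : Fin n → Fin n → Set
  Apart u v = ¬ u ~ v × u ≢ v

  Induced : List (Fin n) → Set
  Induced [] = ⊤
  Induced (x ∷ []) = ⊤
  Induced (x ∷ y ∷ r) = x ~ y × All (Apart x) r × Induced (y ∷ r)

  Induced-tail : ∀ {x} xs → Induced (x ∷ xs) → Induced xs
  Induced-tail [] _ = tt
  Induced-tail (_ ∷ _) (_ , _ , ind) = ind

  Induced-init : ∀ xs {t} → Induced (xs ++ [ t ]) → Induced xs
  Induced-init [] _ = tt
  Induced-init (x ∷ []) _ = tt
  Induced-init (x ∷ y ∷ r) (x~y , apart , ind) = x~y , ++⁻ˡ r apart , Induced-init (y ∷ r) ind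

  Induced-++ : ∀ xs {t} ys → Induced (xs ++ [ t ]) → Induced (t ∷ ys) →
               All (λ x → All (Apart x) ys) xs → Induced (xs ++ t ∷ ys)
  Induced-++ [] ys _ ind _ = ind
  Induced-++ (x ∷ []) ys (x~t , _) ind (x-ys ∷ []) = x~t , x-ys , ind
  Induced-++ (x ∷ y ∷ r) ys (x~y , apart , ind) ind' (x-ys ∷ cross) with ++⁻ r apart
  ... | x-r , x-t ∷ [] = x~y , ++⁺ x-r (x-t ∷ x-ys) , Induced-++ (y ∷ r) ys ind ind' cross

  PathConsec : ∀ {k} → Fin k → Fin k → Set
  PathConsec i j = toℕ j ≡ suc (toℕ i) ⊎ toℕ i ≡ suc (toℕ j)

  PathConsec-sym : ∀ {k} {i j : Fin k} → PathConsec i j → PathConsec j i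
  PathConsec-sym (inj₁ e) = inj₂ e
  PathConsec-sym (inj₂ e) = inj₁ e

  Induced-lookup-head : ∀ x y r → Induced (x ∷ y ∷ r) → ∀ j →
    x ~ lookup (x ∷ y ∷ r) j ⇔ PathConsec {length (x ∷ y ∷ r)} zero j
  Induced-lookup-head x y r _ zero = mk⇔ (λ x~x → ⊥-elim (~-irrefl x~x)) λ { (inj₁ ()) ; (inj₂ ()) }
  Induced-lookup-head x y r (x~y , _) (suc zero) = mk⇔ (λ _ → inj₁ refl) (λ _ → x~y)
  Induced-lookup-head x y r (_ , apart , _) (suc (suc j)) =
    mk⇔ (λ x~ → ⊥-elim (proj₁ (All.lookup apart (∈-lookup j)) x~)) λ { (inj₁ ()) ; (inj₂ ()) }

  Induced-lookup : ∀ xs → Induced xs → ∀ i j → lookup xs i ~ lookup xs j ⇔ PathConsec i j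
  Induced-lookup (x ∷ []) _ zero zero = mk⇔ (λ x~x → ⊥-elim (~-irrefl x~x)) λ { (inj₁ ()) ; (inj₂ ()) }
  Induced-lookup (x ∷ y ∷ r) ind zero j = Induced-lookup-head x y r ind j
  Induced-lookup (x ∷ y ∷ r) ind (suc i) zero =
    mk⇔ (λ ~x → PathConsec-sym (Equivalence.to head (~-sym ~x)))
        (λ c → ~-sym (Equivalence.from head (PathConsec-sym c)))
    where head = Induced-lookup-head x y r ind (suc i)
  Induced-lookup (x ∷ y ∷ r) (_ , _ , ind) (suc i) (suc j) =
    mk⇔ (λ ~ → shift (Equivalence.to tail ~)) (λ c → Equivalence.from tail (unshift c))
    where
    tail = Induced-lookup (y ∷ r) ind i j
    shift : PathConsec i j → PathConsec (suc i) (suc j)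
    shift (inj₁ e) = inj₁ (cong suc e)
    shift (inj₂ e) = inj₂ (cong suc e)
    unshift : PathConsec (suc i) (suc j) → PathConsec i j
    unshift (inj₁ e) = inj₁ (suc-injective e)
    unshift (inj₂ e) = inj₂ (suc-injective e)

  head-unique : ∀ x y r → Induced (x ∷ y ∷ r) → ∀ j → x ≢ lookup (y ∷ r) j
  head-unique x y r (x~y , _) zero refl = ~-irrefl x~y
  head-unique x y r (_ , apart , _) (suc j) = proj₂ (All.lookup apart (∈-lookup j))

  Induced-lookup-injective : ∀ xs → Induced xs → ∀ i j → lookup xs i ≡ lookup xs j → i ≡ j
  Induced-lookup-injective (x ∷ []) _ zero zero _ = refl
  Induced-lookup-injective (x ∷ y ∷ r) _ zero zero _ = refl
  Induced-lookup-injective (x ∷ y ∷ r) ind zero (suc j) e = ⊥-elim (head-unique x y r ind j e)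
  Induced-lookup-injective (x ∷ y ∷ r) ind (suc i) zero e = ⊥-elim (head-unique x y r ind i (sym e))
  Induced-lookup-injective (x ∷ y ∷ r) (_ , _ , ind) (suc i) (suc j) e =
    cong suc (Induced-lookup-injective (y ∷ r) ind i j e)

  AdjOnlyLast : Fin n → List (Fin n) → Set
  AdjOnlyLast c [] = ⊥
  AdjOnlyLast c (w ∷ []) = c ~ w
  AdjOnlyLast c (w ∷ v ∷ r) = ¬ c ~ w × AdjOnlyLast c (v ∷ r)

  AdjOnlyLast-∷ : ∀ {c w} ys → ¬ c ~ w → AdjOnlyLast c ys → AdjOnlyLast c (w ∷ ys)
  AdjOnlyLast-∷ (v ∷ r) ¬c~w only = ¬c~w , only

  AdjOnlyLast-++ : ∀ {c} xs {ys} → All (λ v → ¬ c ~ v) xs → AdjOnlyLast c ys → AdjOnlyLast c (xs ++ ys)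
  AdjOnlyLast-++ [] _ only = only
  AdjOnlyLast-++ (x ∷ xs) (¬c~x ∷ nonadj) only = AdjOnlyLast-∷ (xs ++ _) ¬c~x (AdjOnlyLast-++ xs nonadj only)

  Induced⇒AdjOnlyLast : ∀ y ys {t} → Induced (y ∷ ys ++ [ t ]) → AdjOnlyLast t (y ∷ ys)
  Induced⇒AdjOnlyLast y [] (y~t , _) = ~-sym y~t
  Induced⇒AdjOnlyLast y (y' ∷ ys) (_ , apart , ind) =
    (λ t~y → proj₁ (All.head (++⁻ʳ ys apart)) (~-sym t~y)) , Induced⇒AdjOnlyLast y' ys ind

  AdjOnlyLast-lookup : ∀ c ys → AdjOnlyLast c ys → ∀ j → c ~ lookup ys j ⇔ suc (toℕ j) ≡ length ys
  AdjOnlyLast-lookup c (w ∷ []) c~w zero = mk⇔ (λ _ → refl) (λ _ → c~w)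
  AdjOnlyLast-lookup c (w ∷ v ∷ r) (¬c~w , _) zero = mk⇔ (λ c~w → ⊥-elim (¬c~w c~w)) λ ()
  AdjOnlyLast-lookup c (w ∷ v ∷ r) (_ , only) (suc j) =
    mk⇔ (λ c~ → cong suc (Equivalence.to tail c~)) (λ e → Equivalence.from tail (suc-injective e))
    where tail = AdjOnlyLast-lookup c (v ∷ r) only j

  Consec-sym : ∀ {k} {i j : Fin k} → Consec k i j → Consec k j i
  Consec-sym (inj₁ e) = inj₂ (inj₁ e)
  Consec-sym (inj₂ (inj₁ e)) = inj₁ e
  Consec-sym (inj₂ (inj₂ (inj₁ e))) = inj₂ (inj₂ (inj₂ e))
  Consec-sym (inj₂ (inj₂ (inj₂ e))) = inj₂ (inj₂ (inj₁ e))

  close-induced-path : ∀ c y ys → Induced (y ∷ ys) → c ~ y → AdjOnlyLast c ys → All (c ≢_) (y ∷ ys) →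
    IsInducedCycle G (length (c ∷ y ∷ ys)) (lookup (c ∷ y ∷ ys))
  close-induced-path c y ys ind c~y only c≢ = injective , adjacency
    where
    k = length (c ∷ y ∷ ys)
    cyc = lookup (c ∷ y ∷ ys)

    injective : ∀ {i j} → cyc i ≡ cyc j → i ≡ j
    injective {zero} {zero} _ = refl
    injective {zero} {suc j} e = ⊥-elim (All.lookup c≢ (∈-lookup j) e)
    injective {suc i} {zero} e = ⊥-elim (All.lookup c≢ (∈-lookup i) (sym e))
    injective {suc i} {suc j} e = cong suc (Induced-lookup-injective (y ∷ ys) ind i j e)

    from-c : ∀ j → c ~ lookup (y ∷ ys) j ⇔ Consec k zero (suc j)
    from-c zero = mk⇔ (λ _ → inj₁ refl) (λ _ → c~y)
    from-c (suc j) =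
      mk⇔ (λ c~ → inj₂ (inj₂ (inj₁ (refl , cong (λ m → suc (suc m)) (Equivalence.to last c~)))))
          λ { (inj₁ ()) ; (inj₂ (inj₁ ())) ; (inj₂ (inj₂ (inj₂ (() , _))))
            ; (inj₂ (inj₂ (inj₁ (_ , e)))) → Equivalence.from last (suc-injective (suc-injective e)) }
      where last = AdjOnlyLast-lookup c ys only j

    adjacency : ∀ i j → cyc i ~ cyc j ⇔ Consec k i j
    adjacency zero zero = mk⇔ (λ c~c → ⊥-elim (~-irrefl c~c))
      λ { (inj₁ ()) ; (inj₂ (inj₁ ())) ; (inj₂ (inj₂ (inj₁ (_ , ())))) ; (inj₂ (inj₂ (inj₂ (_ , ())))) }
    adjacency zero (suc j) = from-c j
    adjacency (suc i) zero = mk⇔ (λ ~c → Consec-sym (Equivalence.to (from-c i) (~-sym ~c)))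
                                 (λ con → ~-sym (Equivalence.from (from-c i) (Consec-sym con)))
    adjacency (suc i) (suc j) = mk⇔ (λ ~ → shift (Equivalence.to path ~)) (λ con → Equivalence.from path (unshift con))
      where
      path = Induced-lookup (y ∷ ys) ind i j
      shift : PathConsec i j → Consec k (suc i) (suc j)
      shift (inj₁ e) = inj₁ (cong suc e)
      shift (inj₂ e) = inj₂ (inj₁ (cong suc e))
      unshift : Consec k (suc i) (suc j) → PathConsec i j
      unshift (inj₁ e) = inj₁ (suc-injective e)
      unshift (inj₂ (inj₁ e)) = inj₂ (suc-injective e)
      unshift (inj₂ (inj₂ (inj₁ (() , _))))
      unshift (inj₂ (inj₂ (inj₂ (() , _))))

  record Arc (s t : Fin n) (R : Fin n → Set) : Set where
    constructor arc
    field
      first : Fin n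
      rest : List (Fin n)
      induced : Induced (first ∷ rest ++ [ t ])
      first-adj : s ~ first
      rest-nonadj : All (λ v → ¬ s ~ v) rest
      inside : All R (first ∷ rest)

  shortcut : ∀ {R : Fin n → Set} x l {t} → Induced (l ++ [ t ]) → All R l → x ≢ t →
             Any (λ v → x ≡ v ⊎ x ~ v) (l ++ [ t ]) →
             Σ (List (Fin n)) λ l' → Induced (x ∷ l' ++ [ t ]) × All R l'
  shortcut x [] _ _ x≢t (here (inj₁ x≡t)) = ⊥-elim (x≢t x≡t)
  shortcut x [] _ _ _ (here (inj₂ x~t)) = [] , (x~t , [] , tt) , []
  shortcut x (y ∷ ys) {t} ind (r ∷ rs) x≢t hit
    with Any.any? (λ v → (x ≟ v) ⊎-dec (x ~? v)) (ys ++ [ t ])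
  ... | yes later = shortcut x ys (Induced-tail (ys ++ [ t ]) ind) rs x≢t later
  ... | no none with Any.head none hit
  ...   | inj₁ refl = ys , ind , rs
  ...   | inj₂ x~y = y ∷ ys , (x~y , All.map apart (¬Any⇒All¬ _ none) , ind) , r ∷ rs
    where
    apart : ∀ {v} → ¬ (x ≡ v ⊎ x ~ v) → Apart x v
    apart miss = (λ x~v → miss (inj₂ x~v)) , (λ x≡v → miss (inj₁ x≡v))

  last-neighbour-suffix : ∀ {R : Fin n → Set} s l {t} → Induced (l ++ [ t ]) → All R l → Any (s ~_) l → Arc s t R
  last-neighbour-suffix s (y ∷ ys) ind (r ∷ rs) hit with Any.any? (s ~?_) ys
  ... | yes later = last-neighbour-suffix s ys (Induced-tail (ys ++ _) ind) rs later
  ... | no none = arc y ys ind (Any.head none hit) (¬Any⇒All¬ ys none) (r ∷ rs)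

  walk⇒induced : ∀ {X a b t} → (∀ v → v ∈ X → v ≢ t) → PathIn G X a b → b ~ t →
    Σ (List (Fin n)) λ l → Induced (a ∷ l ++ [ t ]) × All (_∈ X) (a ∷ l)
  walk⇒induced t∉X (here a∈X) a~t = [] , (a~t , [] , tt) , a∈X ∷ []
  walk⇒induced {a = a} t∉X (step a∈X a~w p) b~t with walk⇒induced t∉X p b~t
  ... | l , ind , inX with shortcut a (_ ∷ l) ind inX (t∉X a a∈X) (here (inj₂ a~w))
  ...   | l' , ind' , inX' = l' , ind' , a∈X ∷ inX'

  walk⇒arc : ∀ {X a b s t} → (∀ v → v ∈ X → v ≢ t) → PathIn G X a b → s ~ a → b ~ t → Arc s t (_∈ X)
  walk⇒arc {a = a} {s = s} t∉X p s~a b~t with walk⇒induced t∉X p b~t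
  ... | l , ind , inX = last-neighbour-suffix s (a ∷ l) ind inX (here s~a)

≤-length-++ : ∀ {A : Set} (xs ys : List A) → length ys ≤ length (xs ++ ys)
≤-length-++ xs ys = subst (length ys ≤_) (sym (length-++ xs)) (m≤n+m (length ys) (length xs))

module ClassC {n} (G : Graph n) (𝒞 : InClassC G) where

  open Walks G
  open InducedPaths G

  no-long-hole : ∀ L → 6 ≤ length L → ¬ IsInducedCycle G (length L) (lookup L)
  no-long-hole L 6≤L cyc =
    proj₁ 𝒞 (length L) (lookup L) 6≤L (≤-trans (s≤s (s≤s (s≤s (s≤s z≤n)))) 6≤L , cyc)

  module _ {s t : Fin n} {B R₁ R₂ : Fin n → Set} (s∈B : B s) (t∈B : B t) (s≢t : s ≢ t)
           (R₁∩B : ∀ {v} → R₁ v → ¬ B v) (R₂∩B : ∀ {v} → R₂ v → ¬ B v)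
           (R₁-R₂ : ∀ {u v} → R₁ u → R₂ v → Apart u v) where

    ≢-outside : ∀ {b} {R : Fin n → Set} → B b → (∀ {v} → R v → ¬ B v) → ∀ {v} → R v → b ≢ v
    ≢-outside b∈B R∩B v∈R refl = R∩B v∈R b∈B

    close-arc : (P : Arc s t R₁) → let open Arc P in ∀ Q →
      Induced (t ∷ Q) → All (λ x → All (Apart x) Q) (first ∷ rest) → AdjOnlyLast s (t ∷ Q) → All R₂ Q →
      IsInducedCycle G (length (s ∷ first ∷ rest ++ t ∷ Q)) (lookup (s ∷ first ∷ rest ++ t ∷ Q))
    close-arc (arc first rest induced first-adj rest-nonadj inside) Q ind cross only Q⊆R₂ =
      close-induced-path s first (rest ++ t ∷ Q) (Induced-++ (first ∷ rest) Q induced ind cross) first-adj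
        (AdjOnlyLast-++ rest rest-nonadj only)
        (++⁺ (All.map (≢-outside s∈B R₁∩B) inside) (s≢t ∷ All.map (≢-outside s∈B R₂∩B) Q⊆R₂))

    -- The arc closes through the edge st into a hole; if that hole is a C₅, d extends it.
    adjacent-ends : s ~ t → (P : Arc s t R₁) → 2 ≤ length (Arc.rest P) → ∀ {d} → R₂ d → s ~ d → ⊥
    adjacent-ends _ (arc _ [] _ _ _ _) ()
    adjacent-ends _ (arc _ (_ ∷ []) _ _ _ _) (s≤s ())
    adjacent-ends s~t P@(arc _ (_ ∷ _ ∷ _ ∷ r) _ _ _ _) _ _ _ =
      no-long-hole _ (s≤s (s≤s (s≤s (s≤s (s≤s (≤-length-++ r [ t ]))))))
        (close-arc P [] tt (All.universal (λ _ → []) _) s~t [])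
    adjacent-ends s~t P@(arc y (w ∷ u ∷ []) _ _ _ (y∈R₁ ∷ w∈R₁ ∷ u∈R₁ ∷ [])) _ {d} d∈R₂ s~d =
      proj₂ 𝒞 (attach (d ~? t))
      where
      L = s ∷ y ∷ w ∷ u ∷ t ∷ []
      hole : IsHole G 5 (lookup L)
      hole = s≤s (s≤s (s≤s (s≤s z≤n))) , close-arc P [] tt (All.universal (λ _ → []) _) s~t []
      d∉L : ∀ i → d ≢ lookup L i
      d∉L zero = ≢-outside s∈B R₂∩B d∈R₂ ∘ sym
      d∉L (suc zero) = proj₂ (R₁-R₂ y∈R₁ d∈R₂) ∘ sym
      d∉L (suc (suc zero)) = proj₂ (R₁-R₂ w∈R₁ d∈R₂) ∘ sym
      d∉L (suc (suc (suc zero))) = proj₂ (R₁-R₂ u∈R₁ d∈R₂) ∘ sym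
      d∉L (suc (suc (suc (suc zero)))) = ≢-outside t∈B R₂∩B d∈R₂ ∘ sym
      off : ∀ {v} → R₁ v → {P : Set} → ¬ P → d ~ v ⇔ P
      off v∈R₁ ¬p = mk⇔ (λ d~v → ⊥-elim (proj₁ (R₁-R₂ v∈R₁ d∈R₂) (~-sym d~v))) (λ p → ⊥-elim (¬p p))
      attach : Dec (d ~ t) → HasExtendedC5 G
      attach (yes d~t) = lookup L , d , hole , d∉L ,
        inj₂ (zero , suc (suc (suc (suc zero))) , inj₂ (inj₂ (inj₁ (refl , refl))) , λ where
          zero → mk⇔ (λ _ → inj₁ refl) (λ _ → ~-sym s~d)
          (suc zero) → off y∈R₁ λ { (inj₁ ()) ; (inj₂ ()) }
          (suc (suc zero)) → off w∈R₁ λ { (inj₁ ()) ; (inj₂ ()) }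
          (suc (suc (suc zero))) → off u∈R₁ λ { (inj₁ ()) ; (inj₂ ()) }
          (suc (suc (suc (suc zero)))) → mk⇔ (λ _ → inj₂ refl) (λ _ → d~t))
      attach (no d≁t) = lookup L , d , hole , d∉L , inj₁ (zero , λ where
          zero → mk⇔ (λ _ → refl) (λ _ → ~-sym s~d)
          (suc zero) → off y∈R₁ λ ()
          (suc (suc zero)) → off w∈R₁ λ ()
          (suc (suc (suc zero))) → off u∈R₁ λ ()
          (suc (suc (suc (suc zero)))) → mk⇔ (λ d~t → ⊥-elim (d≁t d~t)) λ ())

    nonadjacent-ends : ¬ s ~ t → (P : Arc s t R₁) → 2 ≤ length (Arc.rest P) → Arc t s R₂ → ⊥
    nonadjacent-ends _ (arc _ [] _ _ _ _) ()
    nonadjacent-ends _ (arc _ (_ ∷ []) _ _ _ _) (s≤s ())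
    nonadjacent-ends s≁t P@(arc _ (_ ∷ _ ∷ r) _ _ _ P⊆R₁) _ (arc q qs Q-induced t~q t≁qs Q⊆R₂) =
      no-long-hole _ (s≤s (s≤s (s≤s (s≤s (≤-trans (s≤s (s≤s z≤n)) (≤-length-++ r (t ∷ q ∷ qs)))))))
        (close-arc P (q ∷ qs) t-Q cross (s≁t , Induced⇒AdjOnlyLast q qs Q-induced) Q⊆R₂)
      where
      t-Q : Induced (t ∷ q ∷ qs)
      t-Q = t~q , All.zipWith (λ (t≁v , v∈R₂) → t≁v , ≢-outside t∈B R₂∩B v∈R₂) (t≁qs , All.tail Q⊆R₂) ,
            Induced-init (q ∷ qs) Q-induced
      cross : All (λ x → All (Apart x) (q ∷ qs)) _
      cross = All.map (λ x∈R₁ → All.map (R₁-R₂ x∈R₁) Q⊆R₂) P⊆R₁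

    arcs-contradict-𝒞 : (P : Arc s t R₁) → 2 ≤ length (Arc.rest P) → Arc t s R₂ → ∀ {d} → R₂ d → s ~ d → ⊥
    arcs-contradict-𝒞 P long Q d∈R₂ s~d with s ~? t
    ... | yes s~t = adjacent-ends s~t P long d∈R₂ s~d
    ... | no s≁t = nonadjacent-ends s≁t P long Q

⟦_⟧ : ∀ {n} {P : Fin n → Set} → Decidable P → Subset n
⟦ P? ⟧ = Vec.tabulate (does ∘ P?)

∈⟦⟧⁻ : ∀ {n} {P : Fin n → Set} (P? : Decidable P) {v} → v ∈ ⟦ P? ⟧ → P v
∈⟦⟧⁻ P? {v} v∈ with P? v | trans (sym (lookup∘tabulate (does ∘ P?) v)) ([]=⇒lookup v∈)
... | yes p | _ = p

∈⟦⟧⁺ : ∀ {n} {P : Fin n → Set} (P? : Decidable P) {v} → P v → v ∈ ⟦ P? ⟧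
∈⟦⟧⁺ P? {v} p = lookup⇒[]= v _ (trans (lookup∘tabulate (does ∘ P?) v) (dec-true (P? v) p))

¬¬-decidable : ∀ {n} (P : Fin n → Set) → ¬ ¬ Decidable P
¬¬-decidable {zero} P k = k λ ()
¬¬-decidable {suc n} P k = ¬¬-decidable (P ∘ suc) λ P∘suc? →
  ¬¬-excluded-middle λ P0? → k λ { zero → P0? ; (suc v) → P∘suc? v }

module Components {n} (G : Graph n) {S : Subset n} where

  open Walks G

  component-closed : ∀ {X C a b} → IsComponent G S C → (∀ v → v ∈ X → v ∉ S) →
                     PathIn G X a b → a ∈ C → b ∈ C
  component-closed _ _ (here _) a∈C = a∈C
  component-closed C@(_ , _ , _ , closed) X∩S (step {w = w} _ a~w p) a∈C =
    component-closed C X∩S p (closed _ w a∈C a~w (X∩S w (path-start p)))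

  components-⊆ : ∀ {C C' v} → IsComponent G S C → IsComponent G S C' → v ∈ C → v ∈ C' → C ⊆ C'
  components-⊆ (_ , C∩S , C-connected , _) C' v∈C v∈C' u∈C =
    component-closed C' C∩S (C-connected _ _ v∈C u∈C) v∈C'

  components-disjoint : ∀ {C C' v} → IsComponent G S C → IsComponent G S C' → C ≢ C' → v ∈ C → v ∉ C'
  components-disjoint C C' C≢C' v∈C v∈C' =
    C≢C' (⊆-antisym (components-⊆ C C' v∈C v∈C') (components-⊆ C' C v∈C' v∈C))

  components-anticomplete : ∀ {C C' u v} → IsComponent G S C → IsComponent G S C' → C ≢ C' →
                            u ∈ C → v ∈ C' → ¬ u ~ v
  components-anticomplete C@(_ , _ , _ , closed) C'@(_ , C'∩S , _ , _) C≢C' u∈C v∈C' u~v =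
    components-disjoint C C' C≢C' (closed _ _ u∈C u~v (C'∩S _ v∈C')) v∈C'

other-full-component : ∀ {n} {G : Graph n} {S : Subset n} → IsMinimalSeparator G S →
  ∀ D → Σ (Subset n) λ D' → IsFullComponent G S D' × D ≢ D'
other-full-component (D₁ , D₂ , D₁≢D₂ , D₁-full , D₂-full) D with ≡-dec Bool._≟_ D D₁
... | yes refl = D₂ , D₂-full , D₁≢D₂
... | no D≢D₁ = D₁ , D₁-full , D≢D₁

module AllNeighboursShared {n} (G : Graph n) (𝒞 : InClassC G) {S D D' Z : Subset n}
  (D-full : IsFullComponent G S D) (D'-full : IsFullComponent G S D') (D≢D' : D ≢ D')
  (Z⊆D : Z ⊆ D) (Z-dominating : Dominating G S Z)
  (Z-minimal : ∀ Z' → Z' ⊆ Z → Dominating G S Z' → Z ⊆ Z')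
  {z : Fin n} (z∈Z : z ∈ Z)
  (shared : ∀ s → s ∈ S → Adj G s z → Σ (Fin n) λ z' → z' ∈ Z × z' ≢ z × Adj G s z')
  where

  open Walks G
  open InducedPaths G
  open Components G
  open ClassC G 𝒞

  Z∩S : ∀ {v} → v ∈ Z → v ∉ S
  Z∩S v∈Z = proj₁ (proj₂ (proj₁ D-full)) _ (Z⊆D v∈Z)

  D'∩S : ∀ {v} → v ∈ D' → v ∉ S
  D'∩S v∈D' = proj₁ (proj₂ (proj₁ D'-full)) _ v∈D'

  Z-D'-apart : ∀ {u v} → u ∈ Z → v ∈ D' → Apart u v
  Z-D'-apart u∈Z v∈D' =
    components-anticomplete (proj₁ D-full) (proj₁ D'-full) D≢D' (Z⊆D u∈Z) v∈D' ,
    λ { refl → components-disjoint (proj₁ D-full) (proj₁ D'-full) D≢D' (Z⊆D u∈Z) v∈D' }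

  neighbour-in : ∀ {C s} → (∀ v → InN G C v ⇔ v ∈ S) → s ∈ S → Σ (Fin n) λ c → c ∈ C × s ~ c
  neighbour-in N[C] s∈S with Equivalence.from (N[C] _) s∈S
  ... | _ , c , c∈C , s~c = c , c∈C , s~c

  Z-neighbour : ∀ {s} → s ∈ S → Σ (Fin n) λ v → v ∈ Z × s ~ v
  Z-neighbour {s} s∈S with proj₂ Z-dominating s s∈S
  ... | _ , v , v∈Z , s~v = v , v∈Z , s~v

  Z-neighbour-≢z : ∀ {s} → s ∈ S → Σ (Fin n) λ v → v ∈ Z × v ≢ z × s ~ v
  Z-neighbour-≢z s∈S with Z-neighbour s∈S
  ... | v , v∈Z , s~v with v ≟ z
  ...   | no v≢z = v , v∈Z , v≢z , s~v
  ...   | yes refl = shared _ s∈S s~v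

  undominated : ∀ {Z' x} → Z' ⊆ Z → Connected G Z' → x ∈ Z → x ∉ Z' →
                Σ (Fin n) λ s → s ∈ S × (∀ {v} → v ∈ Z' → ¬ s ~ v)
  undominated {Z'} Z'⊆Z Z'-connected x∈Z x∉Z'
    with any? (λ s → (s ∈? S) ×-dec ¬? (any? λ v → (v ∈? Z') ×-dec (s ~? v)))
  ... | yes (s , s∈S , none) = s , s∈S , λ v∈Z' s~v → none (_ , v∈Z' , s~v)
  ... | no all-dominated = ⊥-elim (x∉Z' (Z-minimal Z' Z'⊆Z (Z'-connected , dominated) x∈Z))
    where
    dominated : ∀ s → s ∈ S → InN G Z' s
    dominated s s∈S with any? (λ v → (v ∈? Z') ×-dec (s ~? v))
    ... | yes v = (λ s∈Z' → Z∩S (Z'⊆Z s∈Z') s∈S) , v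
    ... | no none = ⊥-elim (all-dominated (s , s∈S , none))

  neighbour-of-z : Σ (Fin n) λ x → x ∈ Z × x ≢ z × x ~ z
  neighbour-of-z with undominated {∅} (⊥-elim ∘ ∉⊥) (λ _ _ → ⊥-elim ∘ ∉⊥) z∈Z ∉⊥
  ... | s , s∈S , _ with Z-neighbour-≢z s∈S
  ...   | v , v∈Z , v≢z , _ = last-step (proj₁ Z-dominating v z v∈Z z∈Z) v≢z

  Z⁻? : Decidable λ v → v ∈ Z × v ≢ z
  Z⁻? v = (v ∈? Z) ×-dec ¬? (v ≟ z)

  Z⁻ : Subset n
  Z⁻ = ⟦ Z⁻? ⟧

  module ReachableFrom (x₁ : Fin n) (x₁∈Z : x₁ ∈ Z) (x₁≢z : x₁ ≢ z) (x₁~z : x₁ ~ z)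
               (reach? : Decidable (PathIn G Z⁻ x₁)) where

    Reach : Fin n → Set
    Reach = PathIn G Z⁻ x₁

    x₁∈Z⁻ : x₁ ∈ Z⁻
    x₁∈Z⁻ = ∈⟦⟧⁺ Z⁻? (x₁∈Z , x₁≢z)

    reach-Z⁻ : ∀ {v} → Reach v → v ∈ Z × v ≢ z
    reach-Z⁻ r = ∈⟦⟧⁻ Z⁻? (path-end r)

    unreachable : Σ (Fin n) λ x → x ∈ Z × x ≢ z × ¬ Reach x
    unreachable with any? (λ x → Z⁻? x ×-dec ¬? (reach? x))
    ... | yes (x , (x∈Z , x≢z) , ¬r) = x , x∈Z , x≢z , ¬r
    ... | no none with undominated (proj₁ ∘ ∈⟦⟧⁻ Z⁻?) Z⁻-connected z∈Z (λ z∈Z⁻ → proj₂ (∈⟦⟧⁻ Z⁻? z∈Z⁻) refl)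
      where
      Z⁻-connected : Connected G Z⁻
      Z⁻-connected = connected-from λ u u∈Z⁻ →
        decidable-stable (reach? u) λ ¬r → none (u , ∈⟦⟧⁻ Z⁻? u∈Z⁻ , ¬r)
    ...   | s , s∈S , s≁Z⁻ with Z-neighbour-≢z s∈S
    ...     | v , v∈Z , v≢z , s~v = ⊥-elim (s≁Z⁻ (∈⟦⟧⁺ Z⁻? (v∈Z , v≢z)) s~v)

    Z₁? : Decidable λ v → v ≡ z ⊎ Reach v
    Z₁? v = (v ≟ z) ⊎-dec reach? v

    Z₁ : Subset n
    Z₁ = ⟦ Z₁? ⟧

    Z₂? : Decidable λ v → v ∈ Z × ¬ Reach v
    Z₂? v = (v ∈? Z) ×-dec ¬? (reach? v)

    Z₂ : Subset n
    Z₂ = ⟦ Z₂? ⟧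

    Z₁⊆Z : Z₁ ⊆ Z
    Z₁⊆Z v∈Z₁ with ∈⟦⟧⁻ Z₁? v∈Z₁
    ... | inj₁ refl = z∈Z
    ... | inj₂ r = proj₁ (reach-Z⁻ r)

    Z₂⊆Z : Z₂ ⊆ Z
    Z₂⊆Z = proj₁ ∘ ∈⟦⟧⁻ Z₂?

    reach-path : ∀ {a u} → Reach a → PathIn G Z⁻ a u → PathIn G Z₁ a u
    reach-path r (here _) = here (∈⟦⟧⁺ Z₁? (inj₂ r))
    reach-path r (step _ a~w p) = step (∈⟦⟧⁺ Z₁? (inj₂ r)) a~w (reach-path (path-snoc r a~w (path-start p)) p)

    Z₁-connected : Connected G Z₁
    Z₁-connected = connected-from λ u u∈Z₁ → from-x₁ (∈⟦⟧⁻ Z₁? u∈Z₁)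
      where
      from-x₁ : ∀ {u} → u ≡ z ⊎ Reach u → PathIn G Z₁ x₁ u
      from-x₁ (inj₁ refl) = step (∈⟦⟧⁺ Z₁? (inj₂ (here x₁∈Z⁻))) x₁~z (here (∈⟦⟧⁺ Z₁? (inj₁ refl)))
      from-x₁ (inj₂ r) = reach-path (here x₁∈Z⁻) r

    -- Before it first meets z, a Z-walk from an unreachable vertex stays in Z⁻, hence unreachable.
    unreachable-path : ∀ {u} → PathIn G Z u z → ¬ Reach u → PathIn G Z₂ u z
    unreachable-path (here u∈Z) ¬r = here (∈⟦⟧⁺ Z₂? (u∈Z , ¬r))
    unreachable-path {u} (step u∈Z u~w p) ¬r with u ≟ z
    ... | yes refl = here (∈⟦⟧⁺ Z₂? (u∈Z , ¬r))
    ... | no u≢z = step (∈⟦⟧⁺ Z₂? (u∈Z , ¬r)) u~w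
                     (unreachable-path p λ r → ¬r (path-snoc r (~-sym u~w) (∈⟦⟧⁺ Z⁻? (u∈Z , u≢z))))

    Z₂-connected : Connected G Z₂
    Z₂-connected = connected-from {r = z} λ u u∈Z₂ →
      path-reverse (unreachable-path (proj₁ Z-dominating u z (Z₂⊆Z u∈Z₂) z∈Z) (proj₂ (∈⟦⟧⁻ Z₂? u∈Z₂)))

    module Terminals {t₁ t₂} (t₁∈S : t₁ ∈ S) (t₁≁Z₂ : ∀ {v} → v ∈ Z₂ → ¬ t₁ ~ v)
                        (t₂∈S : t₂ ∈ S) (t₂≁Z₁ : ∀ {v} → v ∈ Z₁ → ¬ t₂ ~ v) where

      t₁-reach : ∀ {v} → v ∈ Z → t₁ ~ v → Reach v
      t₁-reach {v} v∈Z t₁~v = decidable-stable (reach? v) λ ¬r → t₁≁Z₂ (∈⟦⟧⁺ Z₂? (v∈Z , ¬r)) t₁~v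

      t₂≁reach : ∀ {v} → Reach v → ¬ t₂ ~ v
      t₂≁reach r = t₂≁Z₁ (∈⟦⟧⁺ Z₁? (inj₂ r))

      t₁≢t₂ : t₁ ≢ t₂
      t₁≢t₂ refl with Z-neighbour t₁∈S
      ... | v , v∈Z , t₁~v = t₂≁reach (t₁-reach v∈Z t₁~v) t₁~v

      arc-meets-z : ∀ y ys → Induced (y ∷ ys ++ [ t₂ ]) → All (_∈ Z) ys → Reach y → Any (_≡ z) ys
      arc-meets-z y [] (y~t₂ , _) _ r = ⊥-elim (t₂≁reach r (~-sym y~t₂))
      arc-meets-z y (w ∷ ws) (y~w , _ , ind) (w∈Z ∷ ws∈Z) r with w ≟ z
      ... | yes w≡z = here w≡z
      ... | no w≢z = there (arc-meets-z w ws ind ws∈Z (path-snoc r y~w (∈⟦⟧⁺ Z⁻? (w∈Z , w≢z))))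

      arc-long : (P : Arc t₁ t₂ (_∈ Z)) → 2 ≤ length (Arc.rest P)
      arc-long (arc y [] ind t₁~y _ (y∈Z ∷ [])) with arc-meets-z y [] ind [] (t₁-reach y∈Z t₁~y)
      ... | ()
      arc-long (arc y (w ∷ []) ind@(_ , _ , w~t₂ , _) t₁~y _ (y∈Z ∷ w∈Z))
        with arc-meets-z y (w ∷ []) ind w∈Z (t₁-reach y∈Z t₁~y)
      ... | here refl = ⊥-elim (t₂≁Z₁ (∈⟦⟧⁺ Z₁? (inj₁ refl)) (~-sym w~t₂))
      arc-long (arc _ (_ ∷ _ ∷ _) _ _ _ _) = s≤s (s≤s z≤n)

      absurd : ⊥
      absurd with Z-neighbour t₁∈S | Z-neighbour t₂∈S | neighbour-in (proj₂ D'-full) t₁∈S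
                | neighbour-in (proj₂ D'-full) t₂∈S
      ... | a , a∈Z , t₁~a | b , b∈Z , t₂~b | d₁ , d₁∈D' , t₁~d₁ | d₂ , d₂∈D' , t₂~d₂ =
        arcs-contradict-𝒞 {B = _∈ S} t₁∈S t₂∈S t₁≢t₂ Z∩S D'∩S Z-D'-apart P (arc-long P) Q d₁∈D' t₁~d₁
        where
        P : Arc t₁ t₂ (_∈ Z)
        P = walk⇒arc (λ { _ v∈Z refl → Z∩S v∈Z t₂∈S }) (proj₁ Z-dominating a b a∈Z b∈Z) t₁~a (~-sym t₂~b)
        Q : Arc t₂ t₁ (_∈ D')
        Q = walk⇒arc (λ { _ v∈D' refl → D'∩S v∈D' t₁∈S })
              (proj₁ (proj₂ (proj₂ (proj₁ D'-full))) d₂ d₁ d₂∈D' d₁∈D') t₂~d₂ (~-sym t₁~d₁)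

    absurd : ⊥
    absurd with unreachable
    ... | x , x∈Z , x≢z , ¬r
        with undominated Z₁⊆Z Z₁-connected x∈Z (λ x∈Z₁ → [ x≢z , ¬r ]′ (∈⟦⟧⁻ Z₁? x∈Z₁))
           | undominated Z₂⊆Z Z₂-connected x₁∈Z (λ x₁∈Z₂ → proj₂ (∈⟦⟧⁻ Z₂? x₁∈Z₂) (here x₁∈Z⁻))
    ...    | t₂ , t₂∈S , t₂≁Z₁ | t₁ , t₁∈S , t₁≁Z₂ = Terminals.absurd t₁∈S t₁≁Z₂ t₂∈S t₂≁Z₁

  absurd : ⊥
  absurd with neighbour-of-z
  ... | x₁ , x₁∈Z , x₁≢z , x₁~z = ¬¬-decidable (PathIn G Z⁻ x₁) (ReachableFrom.absurd x₁ x₁∈Z x₁≢z x₁~z)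

module PrivateNeighbours {n} (G : Graph n) (S Z : Subset n) (z : Fin n) where

  open Walks G

  IsPrivateNeighbour : Fin n → Set
  IsPrivateNeighbour s = s ∈ S × s ~ z × (∀ z' → z' ∈ Z → s ~ z' → z' ≡ z)

  private-neighbour? : Dec (Σ (Fin n) IsPrivateNeighbour)
  private-neighbour? = any? λ s →
    (s ∈? S) ×-dec ((s ~? z) ×-dec all? λ z' → (z' ∈? Z) →-dec ((s ~? z') →-dec (z' ≟ z)))

  no-private⇒shared : ¬ Σ (Fin n) IsPrivateNeighbour →
    ∀ s → s ∈ S → s ~ z → Σ (Fin n) λ z' → z' ∈ Z × z' ≢ z × s ~ z'
  no-private⇒shared none s s∈S s~z with any? (λ z' → (z' ∈? Z) ×-dec ((s ~? z') ×-dec ¬? (z' ≟ z)))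
  ... | yes (z' , z'∈Z , s~z' , z'≢z) = z' , z'∈Z , z'≢z , s~z'
  ... | no no-other = ⊥-elim (none (s , s∈S , s~z , λ z' z'∈Z s~z' →
          decidable-stable (z' ≟ z) λ z'≢z → no-other (z' , z'∈Z , s~z' , z'≢z)))

lemma3p3 : ∀ {n} (G : Graph n) (S D Z : Subset n) →
    InClassC G → IsMinimalSeparator G S → IsFullComponent G S D →
    Z ⊆ D → Dominating G S Z →
    (∀ Z' → Z' ⊆ Z → Dominating G S Z' → Z ⊆ Z') →
    ∀ z → z ∈ Z →
    Σ (Fin n) λ s → s ∈ S × Adj G s z × (∀ z' → z' ∈ Z → Adj G s z' → z' ≡ z)
lemma3p3 G S D Z 𝒞 S-minimal D-full Z⊆D Z-dominating Z-minimal z z∈Z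
  with PrivateNeighbours.private-neighbour? G S Z z
... | yes found = found
... | no none with other-full-component S-minimal D
...   | D' , D'-full , D≢D' = ⊥-elim (AllNeighboursShared.absurd G 𝒞 D-full D'-full D≢D' Z⊆D Z-dominating Z-minimal z∈Z
                                      (PrivateNeighbours.no-private⇒shared G S Z z none))
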